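{- Let $(S,A,\to)$ be an image-finite labelled transition system, let $s\in S$, let $C[]$ be a context over ${\it HML}^{+}$, let $I$ be an arbitrary index set and let $\phi_i\in{\it HML}^{+}$ for $i\in I$. Then $s\models C[\bigvee_{i\in I}\phi_i]$ if and only if $s\models C[\bigvee_{i\in J}\phi_i]$ for some finite subset $J\subseteq I$.
   Context: A labelled transition system (LTS) consists of a set $S$ of states, a set $A$ of actions and a set of transitions $s\xrightarrow{a}s'$ with $s,s'\in S$, $a\in A$. It is image-finite if for each $s\in S$ and $a\in A$ there are only finitely many transitions $s\xrightarrow{a}s'$. The negation-free Hennessy-Milner logic ${\it HML}^{+}$ has formulas $\phi ::= {\sf T} \mid {\sf F} \mid \bigwedge_{i\in I}\phi_i \mid \bigvee_{i\in I}\phi_i \mid \langle a\rangle\phi \mid [a]\,\phi$, where $a\in A$ and $I$ is an arbitrary (possibly infinite or empty) index set. Satisfaction: $s\models{\sf T}$; $s\not\models{\sf F}$; $s\models\bigwedge_{i\in I}\phi_i$ iff $s\models\phi_i$ for all $i\in I$; $s\models\bigvee_{i\in I}\phi_i$ iff $s\models\phi_i$ for some $i\in I$; $s\models\langle a\rangle\phi$ iff there is $s'$ with $s\xrightarrow{a}s'$ and $s'\models\phi$; $s\models[a]\,\phi$ iff for all $s'$ with $s\xrightarrow{a}s'$, $s'\models\phi$. A context $C[]$ is a formula containing exactly one occurrence of a hole $[]$ in place of a subformula; $C[\phi]$ is obtained by replacing the hole by $\phi$. -}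

module Defs where

open import Data.Product using (Σ; _×_; _,_)
open import Data.Sum using (_⊎_; inj₁; inj₂)
open import Data.Unit using (⊤; tt)
open import Data.Empty using (⊥)
open import Data.List using (List; length; lookup)
open import Data.List.Membership.Propositional using (_∈_)
open import Data.Fin using (Fin)
open import Function using (_⇔_; _∘_)

record LTS : Set₁ where
  field
    State  : Set
    Action : Set
    _⟶[_]_ : State → Action → State → Set

ImageFinite : LTS → Set
ImageFinite L = ∀ s a → Σ (List State) λ succs → ∀ s' → (s ⟶[ a ] s') ⇔ (s' ∈ succs)
  where open LTS L

data HML (Act : Set) : Set₁ where
  T F : HML Act
  ⋀   : (I : Set) → (I → HML Act) → HML Act
  ⋁   : (I : Set) → (I → HML Act) → HML Act
  ⟨_⟩_ : Act → HML Act → HML Act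
  [_]_ : Act → HML Act → HML Act

module _ (L : LTS) where
  open LTS L

  _⊨_ : State → HML Action → Set
  s ⊨ T = ⊤
  s ⊨ F = ⊥
  s ⊨ ⋀ I φ = (i : I) → s ⊨ φ i
  s ⊨ ⋁ I φ = Σ I λ i → s ⊨ φ i
  s ⊨ (⟨ a ⟩ φ) = Σ State λ s' → (s ⟶[ a ] s') × (s' ⊨ φ)
  s ⊨ ([ a ] φ) = (s' : State) → s ⟶[ a ] s' → s' ⊨ φ

-- A conjunction (disjunction)
-- one of whose conjuncts (disjuncts) contains the hole is represented by
-- the family I → HML of the other conjuncts together with the context
-- for the distinguished one.
data Ctx (Act : Set) : Set₁ where
  hole : Ctx Act
  ⋀c   : (I : Set) → (I → HML Act) → Ctx Act → Ctx Act
  ⋁c   : (I : Set) → (I → HML Act) → Ctx Act → Ctx Act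
  ⟨_⟩c_ : Act → Ctx Act → Ctx Act
  [_]c_ : Act → Ctx Act → Ctx Act

_[_] : ∀ {Act} → Ctx Act → HML Act → HML Act
hole       [ ψ ] = ψ
⋀c I φ C   [ ψ ] = ⋀ (I ⊎ ⊤) λ { (inj₁ i) → φ i ; (inj₂ _) → C [ ψ ] }
⋁c I φ C   [ ψ ] = ⋁ (I ⊎ ⊤) λ { (inj₁ i) → φ i ; (inj₂ _) → C [ ψ ] }
(⟨ a ⟩c C) [ ψ ] = ⟨ a ⟩ (C [ ψ ])
([ a ]c C) [ ψ ] = [ a ] (C [ ψ ])

-- Disjunction over a finite subset J ⊆ I, J given as a finite list of
-- elements of I.
⋁fin : ∀ {Act} {I : Set} → (I → HML Act) → List I → HML Act
⋁fin φ J = ⋁ (Fin (length J)) (φ ∘ lookup J)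

module Submission where

-- The direction from C[⋁_{i∈J} φ_i] to C[⋁_{i∈I} φ_i] needs no hypothesis:
-- the finite disjunction entails the infinite one, and every negation-free
-- context is monotone with respect to semantic entailment.
--
-- Hole, conjunction, disjunction and diamond contexts pass the
-- witness through (an untouched conjunct or disjunct needs nothing, so J = []
-- suffices there).  The box case is where image-finiteness is used: the
-- a-successors of s form a finite list, each successor yields its own index
-- list, and since "s' satisfies C[⋁_{i∈J} φ_i]" is upward closed in J
-- (again by monotonicity of contexts), the concatenation of these
-- finitely many lists is a single J that works for all successors at once.

open import Defs
open import Data.Product using (Σ; _,_; proj₁; proj₂)
open import Data.Sum using (inj₁; inj₂)
open import Data.Unit using (tt)
open import Data.List using (List; []; _∷_; _++_; lookup)
open import Data.List.Relation.Unary.Any using (here; there; index)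
open import Data.List.Relation.Unary.Any.Properties using (lookup-index)
open import Data.List.Membership.Propositional using (_∈_)
open import Data.List.Membership.Propositional.Properties using (∈-lookup)
open import Data.List.Relation.Binary.Subset.Propositional using (_⊆_)
open import Data.List.Relation.Binary.Subset.Propositional.Properties
  using (xs⊆xs++ys; xs⊆ys++xs)
open import Data.Fin using (zero)
open import Relation.Binary.PropositionalEquality using (refl; subst)
open import Function using (_⇔_; mk⇔; Equivalence)

common-witness : ∀ {X Y : Set} (P : X → List Y → Set)
  → (∀ x {J J'} → J ⊆ J' → P x J → P x J')
  → (xs : List X) → (∀ {x} → x ∈ xs → Σ (List Y) (P x))
  → Σ (List Y) λ J → ∀ {x} → x ∈ xs → P x J
common-witness P up [] each = [] , λ ()
common-witness P up (x ∷ xs) each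
  with each (here refl) | common-witness P up xs (λ m → each (there m))
... | J₁ , p₁ | J₂ , p₂ = J₁ ++ J₂ , all
  where
    all : ∀ {y} → y ∈ x ∷ xs → P y (J₁ ++ J₂)
    all (here refl) = up x (xs⊆xs++ys J₁ J₂) p₁
    all (there m)   = up _ (xs⊆ys++xs J₂ J₁) (p₂ m)

module _ (L : LTS) where
  open LTS L

  infix 4 _⊨'_ _⇛_

  _⊨'_ : State → HML Action → Set
  _⊨'_ = _⊨_ L

  _⇛_ : HML Action → HML Action → Set
  ψ ⇛ ψ' = ∀ t → t ⊨' ψ → t ⊨' ψ'

  ctx-monotone : (C : Ctx Action) {ψ ψ' : HML Action} → ψ ⇛ ψ' → C [ ψ ] ⇛ C [ ψ' ]
  ctx-monotone hole       ψ⇛ψ' s p = ψ⇛ψ' s p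
  ctx-monotone (⋀c I φ C) ψ⇛ψ' s p (inj₁ i) = p (inj₁ i)
  ctx-monotone (⋀c I φ C) ψ⇛ψ' s p (inj₂ u) = ctx-monotone C ψ⇛ψ' s (p (inj₂ u))
  ctx-monotone (⋁c I φ C) ψ⇛ψ' s (inj₁ i , p) = inj₁ i , p
  ctx-monotone (⋁c I φ C) ψ⇛ψ' s (inj₂ u , p) = inj₂ u , ctx-monotone C ψ⇛ψ' s p
  ctx-monotone (⟨ a ⟩c C) ψ⇛ψ' s (s' , tr , p) = s' , tr , ctx-monotone C ψ⇛ψ' s' p
  ctx-monotone ([ a ]c C) ψ⇛ψ' s p s' tr = ctx-monotone C ψ⇛ψ' s' (p s' tr)

  module _ {I : Set} (φ : I → HML Action) where

    ⋁fin⇛⋁ : (J : List I) → ⋁fin φ J ⇛ ⋁ I φ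
    ⋁fin⇛⋁ J t (k , p) = lookup J k , p

    ⋁fin-mono : {J J' : List I} → J ⊆ J' → ⋁fin φ J ⇛ ⋁fin φ J'
    ⋁fin-mono {J} J⊆J' t (k , p) =
      index k∈J' , subst (λ i → t ⊨' φ i) (lookup-index k∈J') p
      where k∈J' = J⊆J' (∈-lookup {xs = J} k)

    compact : ImageFinite L → (C : Ctx Action) (s : State)
      → s ⊨' C [ ⋁ I φ ] → Σ (List I) λ J → s ⊨' C [ ⋁fin φ J ]
    compact IF hole s (i , p) = i ∷ [] , zero , p
    compact IF (⋀c I' ψ C) s p with compact IF C s (p (inj₂ tt))
    ... | J , q = J , λ { (inj₁ i) → p (inj₁ i) ; (inj₂ _) → q }
    compact IF (⋁c I' ψ C) s (inj₁ i , p) = [] , inj₁ i , p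
    compact IF (⋁c I' ψ C) s (inj₂ u , p) with compact IF C s p
    ... | J , q = J , inj₂ u , q
    compact IF (⟨ a ⟩c C) s (s' , tr , p) with compact IF C s' p
    ... | J , q = J , s' , tr , q
    compact IF ([ a ]c C) s p with IF s a
    ... | succs , succ⇔ = J , λ s' tr → all-succs (Equivalence.to (succ⇔ s') tr)
      where
        each : ∀ {t} → t ∈ succs → Σ (List I) λ J → t ⊨' C [ ⋁fin φ J ]
        each {t} m = compact IF C t (p t (Equivalence.from (succ⇔ t) m))

        common : Σ (List I) λ J → ∀ {t} → t ∈ succs → t ⊨' C [ ⋁fin φ J ]
        common = common-witness (λ t J → t ⊨' C [ ⋁fin φ J ])
                   (λ t J⊆J' → ctx-monotone C (⋁fin-mono J⊆J') t) succs each

        J : List I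
        J = proj₁ common

        all-succs : ∀ {t} → t ∈ succs → t ⊨' C [ ⋁fin φ J ]
        all-succs = proj₂ common

proposition2 : (L : LTS) → ImageFinite L → (s : LTS.State L)
    → (C : Ctx (LTS.Action L)) (I : Set) (φ : I → HML (LTS.Action L))
    → _⊨_ L s (C [ ⋁ I φ ]) ⇔ Σ (List I) (λ J → _⊨_ L s (C [ ⋁fin φ J ]))
proposition2 L IF s C I φ = mk⇔ (compact L φ IF C s) from-finite
  where
    from-finite : Σ (List I) (λ J → _⊨_ L s (C [ ⋁fin φ J ])) → _⊨_ L s (C [ ⋁ I φ ])
    from-finite (J , p) = ctx-monotone L C (⋁fin⇛⋁ L φ J) s p
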